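{- COWS (restricted to the fragment $P,Q ::= 0 \mid \mathbf{kill}(\kappa) \mid \overline{\tilde a}\langle\tilde n\rangle \mid \tilde a(\tilde x).P \mid [\kappa]P \mid P\mid Q$) is not replacement free: there exist a context $C$, a closed invisible process $I$ and a process $P$ such that $C[I]\Downarrow$ but not $C[P]\Downarrow$.
   Context: COWS (Calculus for Orchestration of Web Services, Lapadula–Pugliese–Tiezzi) uses names and a disjoint set of killer labels $\kappa$, which cannot be communicated and whose scope is given by the delimitation $[\kappa]P$. $\mathbf{kill}(\kappa)$ causes immediate termination of all concurrent processes inside the enclosing $[\kappa]$, which turns the transition label $\kappa$ into $\tau$; kill actions are executed eagerly, i.e. with priority over all other actions of processes within the delimitation of the corresponding killer label. Output $\overline{\tilde a}\langle\tilde n\rangle$ and input $\tilde a(\tilde x).P$ synchronize as in a polyadic $\pi$-calculus with tuple subjects; output and input actions are visible, $\tau$ is invisible. A process is closed if it has no free names. A context is a term with one hole; $C[P]$ is hole filling. $\Rightarrow$ is the reflexive-transitive closure of $\xrightarrow{\tau}$; $P\Downarrow$ iff $P\Rightarrow\xrightarrow{\alpha}\Rightarrow P'$ for some visible $\alpha$; $P$ is invisible iff not $P\Downarrow$. A calculus is replacement free if for every context $C$, closed invisible process $I$ and process $P$, $C[I]\Downarrow$ implies $C[P]\Downarrow$. -}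

module Defs where

open import Data.Nat using (ℕ; _+_)
open import Data.Fin using (Fin; splitAt; _↑ˡ_; _↑ʳ_)
open import Data.Vec using (Vec; lookup; toList)
open import Data.List using (List; map)
open import Data.List.Relation.Unary.All using (All)
open import Data.Sum using (_⊎_; inj₁; inj₂)
open import Data.Product using (Σ; _×_; ∃)
open import Data.Unit using (⊤)
open import Data.Empty using (⊥)
open import Relation.Nullary using (¬_)
open import Relation.Binary.PropositionalEquality using (_≡_)
open import Relation.Binary.Construct.Closure.ReflexiveTransitive using (Star)

-- Variables bound by input
-- prefixes are de Bruijn indices; a process of type Proc n has n
-- variables in scope.

data Name : Set where
  nm : ℕ → Name

data Killer : Set where
  kl : ℕ → Killer

data Tm (n : ℕ) : Set where
  name : Name → Tm n
  var  : Fin n → Tm n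

data Proc (n : ℕ) : Set where
  nil  : Proc n
  kill : Killer → Proc n
  out  : List (Tm n) → List (Tm n) → Proc n              -- ā⟨ñ⟩ (tuple subject ā)
  inp  : List (Tm n) → (m : ℕ) → Proc (m + n) → Proc n
  del  : Killer → Proc n → Proc n
  par  : Proc n → Proc n → Proc n

-- Substitution of variables (names are never bound in this fragment,
-- so substitution is capture-free).

weakenTm : ∀ {k} m → Tm k → Tm (m + k)
weakenTm m (name a) = name a
weakenTm m (var j)  = var (m ↑ʳ j)

ext : ∀ {n k} m → (Fin n → Tm k) → Fin (m + n) → Tm (m + k)
ext {k = k} m σ i with splitAt m i
... | inj₁ j = var (j ↑ˡ k)
... | inj₂ j = weakenTm m (σ j)

subTm : ∀ {n k} → (Fin n → Tm k) → Tm n → Tm k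
subTm σ (name a) = name a
subTm σ (var i)  = σ i

sub : ∀ {n k} → (Fin n → Tm k) → Proc n → Proc k
sub σ nil         = nil
sub σ (kill κ)    = kill κ
sub σ (out as ns) = out (map (subTm σ) as) (map (subTm σ) ns)
sub σ (inp as m P) = inp (map (subTm σ) as) m (sub (ext m σ) P)
sub σ (del κ P)   = del κ (sub σ P)
sub σ (par P Q)   = par (sub σ P) (sub σ Q)

instσ : ∀ {m} → Vec Name m → Fin (m + 0) → Tm 0
instσ {m} vs i with splitAt m i
... | inj₁ j = name (lookup vs j)
... | inj₂ ()

inst : ∀ {m} → Vec Name m → Proc (m + 0) → Proc 0
inst vs P = sub (instσ vs) P

toName : Tm 0 → Name
toName (name a) = a
toName (var ())

names : List (Tm 0) → List Name
names = map toName

-- Closed processes: no free names (killer labels are not names).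

NameFree : ∀ {n} → Tm n → Set
NameFree (name _) = ⊥
NameFree (var _)  = ⊤

Closed : ∀ {n} → Proc n → Set
Closed nil          = ⊤
Closed (kill κ)     = ⊤
Closed (out as ns)  = All NameFree as × All NameFree ns
Closed (inp as m P) = All NameFree as × Closed P
Closed (del κ P)    = Closed P
Closed (par P Q)    = Closed P × Closed Q

-- Labelled transition semantics (COWS style).
--   τ      : communication
--   dag    : silent action produced by a kill reaching its delimitation
--            (the paper's "κ turned into τ"; kept distinct from τ only
--            to express the priority of kill actions, both are invisible)
--   kil κ  : pending kill of κ
--   outL ā ñ / inL ā ñ : visible output / input

data Label : Set where
  τ    : Label
  dag  : Label
  kil  : Killer → Label
  outL : List Name → List Name → Label
  inL  : List Name → List Name → Label

IsKillLabel : Label → Set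
IsKillLabel dag     = ⊤
IsKillLabel (kil _) = ⊤
IsKillLabel _       = ⊥

NotKil : Label → Set
NotKil (kil _) = ⊥
NotKil _       = ⊤

Visible : Label → Set
Visible (outL _ _) = ⊤
Visible (inL _ _)  = ⊤
Visible _          = ⊥

Silent : Label → Set
Silent τ   = ⊤
Silent dag = ⊤
Silent _   = ⊥

-- halt(P): what survives a kill (no protection in this fragment)
halt : ∀ {n} → Proc n → Proc n
halt (par P Q) = par (halt P) (halt Q)
halt (del κ P) = del κ (halt P)
halt _         = nil

ActiveKill : ∀ {n} → Proc n → Set
ActiveKill (kill _)  = ⊤
ActiveKill (par P Q) = ActiveKill P ⊎ ActiveKill Q
ActiveKill (del _ P) = ActiveKill P
ActiveKill _         = ⊥

infix 4 _—[_]→_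

data _—[_]→_ : Proc 0 → Label → Proc 0 → Set where
  out-ax  : ∀ as ns → out as ns —[ outL (names as) (names ns) ]→ nil
  inp-ax  : ∀ as {m} {P} (vs : Vec Name m) →
            inp as m P —[ inL (names as) (toList vs) ]→ inst vs P
  kill-ax : ∀ κ → kill κ —[ kil κ ]→ nil
  parL    : ∀ {P P' Q α} → P —[ α ]→ P' → NotKil α → par P Q —[ α ]→ par P' Q
  parR    : ∀ {P Q Q' α} → Q —[ α ]→ Q' → NotKil α → par P Q —[ α ]→ par P Q'
  parKL   : ∀ {P P' Q κ} → P —[ kil κ ]→ P' → par P Q —[ kil κ ]→ par P' (halt Q)
  parKR   : ∀ {P Q Q' κ} → Q —[ kil κ ]→ Q' → par P Q —[ kil κ ]→ par (halt P) Q'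
  comL    : ∀ {P P' Q Q' a ns} → P —[ outL a ns ]→ P' → Q —[ inL a ns ]→ Q' →
            par P Q —[ τ ]→ par P' Q'
  comR    : ∀ {P P' Q Q' a ns} → P —[ inL a ns ]→ P' → Q —[ outL a ns ]→ Q' →
            par P Q —[ τ ]→ par P' Q'
  delK    : ∀ {P P' κ} → P —[ kil κ ]→ P' → del κ P —[ dag ]→ del κ P'
  delPass : ∀ {P P' κ α} → P —[ α ]→ P' → ¬ (α ≡ kil κ) →
            (ActiveKill P → IsKillLabel α) →       -- kill priority
            del κ P —[ α ]→ del κ P'

_—→_ : Proc 0 → Proc 0 → Set
P —→ Q = Σ Label λ α → Silent α × (P —[ α ]→ Q)

_⇒_ : Proc 0 → Proc 0 → Set
_⇒_ = Star _—→_

_⇓ : Proc 0 → Set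
P ⇓ = ∃ λ P₁ → ∃ λ α → ∃ λ P₂ → ∃ λ P₃ →
      (P ⇒ P₁) × (P₁ —[ α ]→ P₂) × Visible α × (P₂ ⇒ P₃)

Invisible : Proc 0 → Set
Invisible P = ¬ (P ⇓)

data Ctx (h : ℕ) : ℕ → Set where
  hole : Ctx h h
  inpC : ∀ {n} → List (Tm n) → (m : ℕ) → Ctx h (m + n) → Ctx h n
  delC : ∀ {n} → Killer → Ctx h n → Ctx h n
  parCL : ∀ {n} → Ctx h n → Proc n → Ctx h n
  parCR : ∀ {n} → Proc n → Ctx h n → Ctx h n

_[_] : ∀ {h n} → Ctx h n → Proc h → Proc n
hole [ P ]          = P
inpC as m C [ P ]   = inp as m (C [ P ])
delC κ C [ P ]      = del κ (C [ P ])
parCL C Q [ P ]     = par (C [ P ]) Q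
parCR Q C [ P ]     = par Q (C [ P ])

ReplacementFree : Set
ReplacementFree = (C : Ctx 0 0) (I P : Proc 0) →
  Closed I → Invisible I → C [ I ] ⇓ → C [ P ] ⇓

-- The context [κ](ā⟨⟩ | •) exhibits the output ā⟨⟩ when the hole is filled
-- with the invisible 0.  Filled with kill(κ), the kill has priority over
-- the output, so the only move is the silent kill, after which
-- [κ](0 | 0) is stuck: the barb ā is pre-empted.
module Submission where

open import Defs
open import Data.Product using (∃; _×_; _,_)
open import Data.List using ([]; _∷_)
open import Data.Sum using (inj₁; inj₂)
open import Data.Unit using (tt)
open import Data.Empty using (⊥-elim)
open import Relation.Nullary using (¬_)
open import Relation.Binary.PropositionalEquality using (_≡_; refl)
open import Relation.Binary.Construct.Closure.ReflexiveTransitive using (ε; _◅_)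

Stuck : Proc 0 → Set
Stuck P = ∀ {α R} → ¬ (P —[ α ]→ R)

stuck⇒invisible : ∀ {P} → Stuck P → Invisible P
stuck⇒invisible stuck (_ , _ , _ , _ , ε , step , _) = stuck step
stuck⇒invisible stuck (_ , _ , _ , _ , (_ , _ , step) ◅ _ , _) = stuck step

silent⇒¬visible : ∀ {α} → Silent α → ¬ Visible α
silent⇒¬visible {τ}   _ ()
silent⇒¬visible {dag} _ ()

only-silent-to-invisible⇒invisible :
  ∀ {P Q} → (∀ {α R} → P —[ α ]→ R → Silent α × R ≡ Q) →
  Invisible Q → Invisible P
only-silent-to-invisible⇒invisible only inv (_ , _ , _ , _ , ε , step , visible , _)
  with only step
... | silent , _ = silent⇒¬visible silent visible
only-silent-to-invisible⇒invisible only inv (P₁ , α , P₂ , P₃ , (_ , _ , step) ◅ steps , rest)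
  with only step
... | _ , refl = inv (P₁ , α , P₂ , P₃ , steps , rest)

nil-invisible : Invisible nil
nil-invisible = stuck⇒invisible λ ()

κ : Killer
κ = kl 0

barb : Proc 0
barb = out (name (nm 0) ∷ []) []

context : Ctx 0 0
context = delC κ (parCR barb hole)

killed-stuck : Stuck (del κ (par nil nil))
killed-stuck (delK (parKL ()))
killed-stuck (delK (parKR ()))
killed-stuck (delPass (parL () _) _ _)
killed-stuck (delPass (parR () _) _ _)
killed-stuck (delPass (parKL ()) _ _)
killed-stuck (delPass (parKR ()) _ _)
killed-stuck (delPass (comL () _) _ _)
killed-stuck (delPass (comR () _) _ _)

kill-preempts-barb : ∀ {α R} → context [ kill κ ] —[ α ]→ R →
                     Silent α × R ≡ del κ (par nil nil)
kill-preempts-barb (delK (parKL ()))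
kill-preempts-barb (delK (parKR (kill-ax _)))                = tt , refl
kill-preempts-barb (delPass (parL (out-ax _ _) _) _ priority) = ⊥-elim (priority (inj₂ tt))
kill-preempts-barb (delPass (parR (kill-ax _) ()) _ _)
kill-preempts-barb (delPass (parKL ()) _ _)
kill-preempts-barb (delPass (parKR (kill-ax _)) κ≢κ _)       = ⊥-elim (κ≢κ refl)
kill-preempts-barb (delPass (comL (out-ax _ _) ()) _ _)
kill-preempts-barb (delPass (comR () _) _ _)

context-nil-barb : context [ nil ] ⇓
context-nil-barb =
  _ , _ , _ , _ , ε ,
  delPass (parL (out-ax _ _) tt) (λ ()) (λ { (inj₁ ()) ; (inj₂ ()) }) ,
  tt , ε

proposition5p4 : ∃ λ (C : Ctx 0 0) → ∃ λ (I : Proc 0) → ∃ λ (P : Proc 0) →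
    Closed I × Invisible I × (C [ I ] ⇓) × ¬ (C [ P ] ⇓)
proposition5p4 =
  context , nil , kill κ , tt , nil-invisible , context-nil-barb ,
  only-silent-to-invisible⇒invisible kill-preempts-barb (stuck⇒invisible killed-stuck)
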